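{- Let $A\in\mathbb{Z}^{r\times m}$ be abundant and $Q\subseteq[m]$. If $|Q|\geq 2$ then $|Q| - r_Q - 1 > 0$. If $|Q|\leq 2$ then $r_Q = 0$.
   Context: For $Q\subseteq[m]$, $A^Q$ is the submatrix of the columns indexed by $Q$, $\bar Q = [m]\setminus Q$, the empty matrix has rank $0$, and $r_Q = \mathrm{rk}(A) - \mathrm{rk}(A^{\bar Q})$. $A$ is abundant if $\mathrm{rk}(A)>0$ and $\mathrm{rk}(A^Q)=\mathrm{rk}(A)$ for all $Q\subseteq[m]$ with $|Q|\geq m-2$. -}

module Defs where

open import Data.Nat as ℕ using (ℕ; zero; suc)
open import Data.Integer as ℤ using (ℤ; +_)
open import Data.Fin using (Fin; zero; suc)
open import Data.Fin.Subset using (Subset; _∈_; _∉_; _⊆_; ∣_∣; ⊤; ∁)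
open import Data.Product using (Σ; _×_; ∃)
open import Relation.Binary.PropositionalEquality using (_≡_)

Matrix : ℕ → ℕ → Set
Matrix r m = Fin r → Fin m → ℤ

∑ : ∀ {m} → (Fin m → ℤ) → ℤ
∑ {zero}  f = + 0
∑ {suc m} f = f zero ℤ.+ ∑ (λ j → f (suc j))

-- The columns of A indexed by S are linearly independent (over ℤ, equivalently over ℚ):
-- every integer combination of these columns that vanishes is trivial.
Indep : ∀ {r m} → Matrix r m → Subset m → Set
Indep {r} {m} A S =
  (c : Fin m → ℤ) →
  (∀ j → j ∉ S → c j ≡ + 0) →
  (∀ i → ∑ (λ j → c j ℤ.* A i j) ≡ + 0) →
  ∀ j → c j ≡ + 0

RankOn : ∀ {r m} → Matrix r m → Subset m → ℕ → Set
RankOn {r} {m} A Q k =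
  (Σ (Subset m) λ S → S ⊆ Q × ∣ S ∣ ≡ k × Indep A S)
  × (∀ (S : Subset m) → S ⊆ Q → Indep A S → ∣ S ∣ ℕ.≤ k)

Rank : ∀ {r m} → Matrix r m → ℕ → Set
Rank A k = RankOn A ⊤ k

Abundant : ∀ {r m} → Matrix r m → Set
Abundant {r} {m} A =
  (∀ k → Rank A k → 0 ℕ.< k)
  × (∀ (Q : Subset m) k k' → m ℕ.≤ ∣ Q ∣ ℕ.+ 2 → Rank A k → RankOn A Q k' → k' ≡ k)

-- If |Q| ≤ 2 then ∁Q has at least m - 2 columns, so abundance gives rk(A^∁Q) = rk(A).
-- If |Q| ≥ 2, pick Q' ⊆ Q with |Q'| = 2. By abundance A^∁Q' has a set S of rk(A) independent
-- columns; those of S outside Q are independent columns of A^∁Q, and the rest lie in Q ∖ Q', so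
-- rk(A) ≤ rk(A^∁Q) + |Q| - 2. Independence is undecidable, so rk(A^∁Q') exists only under a
-- double negation, which is harmless because the target inequality is decidable.
module Submission where

open import Defs
open import Data.Nat as ℕ using (ℕ; zero; suc; z≤n; s≤s)
import Data.Nat.Properties as ℕ
open import Data.Integer as ℤ using (ℤ; +_; +<+)
import Data.Integer.Properties as ℤ
open import Data.Integer.Tactic.RingSolver using (solve-∀)
open import Data.Fin.Subset using (Subset; ∣_∣; ∁; _⊆_; _∩_; inside; outside; ⊥)
open import Data.Fin.Subset.Properties
  using (drop-∷-⊆; s⊆s; ⊥⊆; ∉⊥; ∣⊥∣≡0; ∣∁p∣≡n∸∣p∣; ∣p∣≤n; p∩q⊆p; p∩q⊆q)
open import Data.Vec using ([]; _∷_; here)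
open import Data.Product using (∃; _×_; _,_)
open import Relation.Binary.PropositionalEquality using (_≡_; refl; sym; trans; cong; subst; subst₂)
open import Relation.Nullary using (¬_; yes; no; contradiction)
open import Relation.Nullary.Decidable using (decidable-stable; ¬¬-excluded-middle)

Indep-antimono : ∀ {r m} (A : Matrix r m) {S' S : Subset m} → S' ⊆ S → Indep A S → Indep A S'
Indep-antimono A S'⊆S indep c vanishes sums =
  indep c (λ j j∉S → vanishes j (λ j∈S' → j∉S (S'⊆S j∈S'))) sums

Indep-⊥ : ∀ {r m} (A : Matrix r m) → Indep A ⊥
Indep-⊥ A c vanishes sums j = vanishes j ∉⊥

subsetOfSize : ∀ {m} (p : Subset m) n → n ℕ.≤ ∣ p ∣ → ∃ λ q → q ⊆ p × ∣ q ∣ ≡ n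
subsetOfSize {m} p         zero    _ = ⊥ , ⊥⊆ , ∣⊥∣≡0 m
subsetOfSize (outside ∷ p) (suc n) 1+n≤∣p∣ with subsetOfSize p (suc n) 1+n≤∣p∣
... | q , q⊆p , ∣q∣≡1+n = outside ∷ q , s⊆s q⊆p , ∣q∣≡1+n
subsetOfSize (inside ∷ p)  (suc n) (s≤s n≤∣p∣) with subsetOfSize p n n≤∣p∣
... | q , q⊆p , ∣q∣≡n = inside ∷ q , s⊆s q⊆p , cong suc ∣q∣≡n

∣p∣+∣∁p∣≡n : ∀ {m} (p : Subset m) → ∣ p ∣ ℕ.+ ∣ ∁ p ∣ ≡ m
∣p∣+∣∁p∣≡n p = trans (cong (∣ p ∣ ℕ.+_) (∣∁p∣≡n∸∣p∣ p)) (ℕ.m+[n∸m]≡n (∣p∣≤n p))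

-- The elements of p inside q avoid r ⊆ q, so there are at most ∣ q ∣ ∸ ∣ r ∣ of them.
∣p∣+∣r∣≤∣p∩∁q∣+∣q∣ : ∀ {m} (p q r : Subset m) → r ⊆ q → p ⊆ ∁ r →
  ∣ p ∣ ℕ.+ ∣ r ∣ ℕ.≤ ∣ p ∩ ∁ q ∣ ℕ.+ ∣ q ∣
∣p∣+∣r∣≤∣p∩∁q∣+∣q∣ [] [] [] _ _ = z≤n
∣p∣+∣r∣≤∣p∩∁q∣+∣q∣ (inside ∷ p) (_ ∷ q) (inside ∷ r) _ p⊆∁r = contradiction (p⊆∁r here) λ ()
∣p∣+∣r∣≤∣p∩∁q∣+∣q∣ (_ ∷ p) (outside ∷ q) (inside ∷ r) r⊆q _ = contradiction (r⊆q here) λ ()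
∣p∣+∣r∣≤∣p∩∁q∣+∣q∣ (inside ∷ p) (inside ∷ q) (outside ∷ r) r⊆q p⊆∁r =
  subst (ℕ._≤_ _) (sym (ℕ.+-suc _ _))
    (s≤s (∣p∣+∣r∣≤∣p∩∁q∣+∣q∣ p q r (drop-∷-⊆ r⊆q) (drop-∷-⊆ p⊆∁r)))
∣p∣+∣r∣≤∣p∩∁q∣+∣q∣ (inside ∷ p) (outside ∷ q) (outside ∷ r) r⊆q p⊆∁r =
  s≤s (∣p∣+∣r∣≤∣p∩∁q∣+∣q∣ p q r (drop-∷-⊆ r⊆q) (drop-∷-⊆ p⊆∁r))
∣p∣+∣r∣≤∣p∩∁q∣+∣q∣ (outside ∷ p) (inside ∷ q) (outside ∷ r) r⊆q p⊆∁r =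
  subst (ℕ._≤_ _) (sym (ℕ.+-suc _ _))
    (ℕ.m≤n⇒m≤1+n (∣p∣+∣r∣≤∣p∩∁q∣+∣q∣ p q r (drop-∷-⊆ r⊆q) (drop-∷-⊆ p⊆∁r)))
∣p∣+∣r∣≤∣p∩∁q∣+∣q∣ (outside ∷ p) (outside ∷ q) (outside ∷ r) r⊆q p⊆∁r =
  ∣p∣+∣r∣≤∣p∩∁q∣+∣q∣ p q r (drop-∷-⊆ r⊆q) (drop-∷-⊆ p⊆∁r)
∣p∣+∣r∣≤∣p∩∁q∣+∣q∣ (outside ∷ p) (inside ∷ q) (inside ∷ r) r⊆q p⊆∁r
  rewrite ℕ.+-suc ∣ p ∣ ∣ r ∣ | ℕ.+-suc ∣ p ∩ ∁ q ∣ ∣ q ∣ =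
  s≤s (∣p∣+∣r∣≤∣p∩∁q∣+∣q∣ p q r (drop-∷-⊆ r⊆q) (drop-∷-⊆ p⊆∁r))

¬¬-maximum : ∀ {p} (P : ℕ → Set p) d → P 0 → (∀ n → P n → n ℕ.≤ d) →
  ¬ ¬ ∃ λ k → P k × (∀ n → P n → n ℕ.≤ k)
¬¬-maximum P zero    p₀ bounded ¬max = ¬max (0 , p₀ , bounded)
¬¬-maximum P (suc d) p₀ bounded ¬max = ¬¬-excluded-middle λ
  { (yes p) → ¬max (suc d , p , bounded)
  ; (no ¬p) → ¬¬-maximum P d p₀
      (λ n pₙ → ℕ.≤-pred (ℕ.≤∧≢⇒< (bounded n pₙ) λ { refl → ¬p pₙ })) ¬max
  }

¬¬-RankOn : ∀ {r m} (A : Matrix r m) (T : Subset m) → ¬ ¬ ∃ (RankOn A T)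
¬¬-RankOn {m = m} A T ¬rank =
  ¬¬-maximum IndepOfSize m (⊥ , ⊥⊆ , ∣⊥∣≡0 m , Indep-⊥ A)
    (λ n (S , _ , ∣S∣≡n , _) → subst (ℕ._≤ m) ∣S∣≡n (∣p∣≤n S))
    (λ (k , indep , maximal) →
      ¬rank (k , indep , λ S S⊆T indepS → maximal ∣ S ∣ (S , S⊆T , refl , indepS)))
  where
  IndepOfSize : ℕ → Set
  IndepOfSize n = ∃ λ S → S ⊆ T × ∣ S ∣ ≡ n × Indep A S

RankOn-∁-antimono : ∀ {r m} (A : Matrix r m) {Q Q' : Subset m} {k' k̄} → Q' ⊆ Q →
  RankOn A (∁ Q') k' → RankOn A (∁ Q) k̄ → k' ℕ.+ ∣ Q' ∣ ℕ.≤ k̄ ℕ.+ ∣ Q ∣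
RankOn-∁-antimono A {Q} {Q'} Q'⊆Q ((S , S⊆∁Q' , refl , indepS) , _) (_ , maximal) =
  ℕ.≤-trans (∣p∣+∣r∣≤∣p∩∁q∣+∣q∣ S Q Q' Q'⊆Q S⊆∁Q')
    (ℕ.+-monoˡ-≤ ∣ Q ∣
      (maximal (S ∩ ∁ Q) (p∩q⊆q S (∁ Q)) (Indep-antimono A (p∩q⊆p S (∁ Q)) indepS)))

Abundant⇒RankOn-∁ : ∀ {r m} (A : Matrix r m) → Abundant A → ∀ {Q k k'} → ∣ Q ∣ ℕ.≤ 2 →
  Rank A k → RankOn A (∁ Q) k' → k' ≡ k
Abundant⇒RankOn-∁ {m = m} A (_ , abundant) {Q} ∣Q∣≤2 = abundant (∁ Q) _ _ m≤∣∁Q∣+2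
  where
  open ℕ.≤-Reasoning
  m≤∣∁Q∣+2 : m ℕ.≤ ∣ ∁ Q ∣ ℕ.+ 2
  m≤∣∁Q∣+2 = begin
    m                   ≡⟨ sym (∣p∣+∣∁p∣≡n Q) ⟩
    ∣ Q ∣ ℕ.+ ∣ ∁ Q ∣   ≤⟨ ℕ.+-monoˡ-≤ ∣ ∁ Q ∣ ∣Q∣≤2 ⟩
    2 ℕ.+ ∣ ∁ Q ∣       ≡⟨ ℕ.+-comm 2 ∣ ∁ Q ∣ ⟩
    ∣ ∁ Q ∣ ℕ.+ 2       ∎

Abundant⇒rank+2≤rank-∁+∣Q∣ : ∀ {r m} (A : Matrix r m) → Abundant A → ∀ {Q k k̄} → 2 ℕ.≤ ∣ Q ∣ →
  Rank A k → RankOn A (∁ Q) k̄ → k ℕ.+ 2 ℕ.≤ k̄ ℕ.+ ∣ Q ∣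
Abundant⇒rank+2≤rank-∁+∣Q∣ A abundant {Q} {k} {k̄} 2≤∣Q∣ rank rank∁Q
  with subsetOfSize Q 2 2≤∣Q∣
... | Q' , Q'⊆Q , ∣Q'∣≡2 = decidable-stable (k ℕ.+ 2 ℕ.≤? k̄ ℕ.+ ∣ Q ∣) λ ¬bound →
  ¬¬-RankOn A (∁ Q') λ (k' , rank∁Q') →
    ¬bound (subst₂ (λ k' n → k' ℕ.+ n ℕ.≤ k̄ ℕ.+ ∣ Q ∣)
      (Abundant⇒RankOn-∁ A abundant (ℕ.≤-reflexive ∣Q'∣≡2) rank rank∁Q') ∣Q'∣≡2
      (RankOn-∁-antimono A Q'⊆Q rank∁Q' rank∁Q))

0<q-[k-k̄]-1 : ∀ q k k̄ → k ℕ.+ 2 ℕ.≤ k̄ ℕ.+ q → + 0 ℤ.< (+ q ℤ.- (+ k ℤ.- + k̄)) ℤ.- + 1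
0<q-[k-k̄]-1 q k k̄ k+2≤k̄+q = begin-strict
  + 0                                   <⟨ +<+ (ℕ.m<n⇒0<n∸m k+1<k̄+q) ⟩
  + (k̄ ℕ.+ q ℕ.∸ (k ℕ.+ 1))             ≡⟨ ℤ.⊖-≥ (ℕ.<⇒≤ k+1<k̄+q) ⟨
  (k̄ ℕ.+ q) ℤ.⊖ (k ℕ.+ 1)               ≡⟨ ℤ.m-n≡m⊖n (k̄ ℕ.+ q) (k ℕ.+ 1) ⟨
  (+ k̄ ℤ.+ + q) ℤ.- (+ k ℤ.+ + 1)       ≡⟨ rearrange (+ q) (+ k) (+ k̄) ⟨
  (+ q ℤ.- (+ k ℤ.- + k̄)) ℤ.- + 1       ∎
  where
  open ℤ.≤-Reasoning
  k+1<k̄+q : k ℕ.+ 1 ℕ.< k̄ ℕ.+ q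
  k+1<k̄+q = subst (ℕ._≤ k̄ ℕ.+ q) (ℕ.+-suc k 1) k+2≤k̄+q
  rearrange : ∀ (a b c : ℤ) → (a ℤ.- (b ℤ.- c)) ℤ.- + 1 ≡ (c ℤ.+ a) ℤ.- (b ℤ.+ + 1)
  rearrange = solve-∀

lemma4p4 : ∀ {r m} (A : Matrix r m) → Abundant A → (Q : Subset m) → (k k̄ : ℕ) →
    Rank A k → RankOn A (∁ Q) k̄ →
    (2 ℕ.≤ ∣ Q ∣ → + 0 ℤ.< (+ ∣ Q ∣ ℤ.- (+ k ℤ.- + k̄)) ℤ.- + 1)
    × (∣ Q ∣ ℕ.≤ 2 → (+ k ℤ.- + k̄) ≡ + 0)
lemma4p4 A abundant Q k k̄ rank rank∁Q =
  (λ 2≤∣Q∣ → 0<q-[k-k̄]-1 ∣ Q ∣ k k̄ (Abundant⇒rank+2≤rank-∁+∣Q∣ A abundant 2≤∣Q∣ rank rank∁Q)) ,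
  (λ ∣Q∣≤2 → ℤ.i≡j⇒i-j≡0 (cong +_ (sym (Abundant⇒RankOn-∁ A abundant ∣Q∣≤2 rank rank∁Q))))
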